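{- Let $\Sigma$ be a spatial conjunction, $s$ a stack and $h$ a heap. If $s,h\models\Sigma$, then $s\models\mathrm{WellFormed}(\Sigma)$.
   Context: Setting: a many-sorted first-order language with sorts including $\mathsf{Int}$ and $\mathsf{Bool}$, equality $\simeq$, classical boolean connectives and possibly further theory symbols. A stack $s$ maps variables to values of their sorts and is extended to pure (spatial-symbol-free) expressions; for a pure formula $F$, $s\models F$ means $s(F)=\top$. A heap is a partial function $h\colon\mathbb{Z}\rightharpoonup\mathsf{Val}$; $h=h_1\ast\dots\ast h_n$ means $h$ is the union of the $h_i$ with pairwise disjoint domains. Spatial predicates: $\mathrm{emp}$, $\mathrm{next}(x,y)$, $\mathrm{lseg}(x,y)$ with $x,y$ pure $\mathsf{Int}$ expressions; a spatial conjunction $\Sigma=S_1\ast\dots\ast S_n$ ($n\ge0$). Semantics: $s,h\models\mathrm{emp}$ iff $h=\emptyset$; $s,h\models\mathrm{next}(x,y)$ iff $h=\{s(x)\mapsto s(y)\}$; $s,h\models F_1\ast F_2$ iff $h=h_1\ast h_2$ with $s,h_i\models F_i$ (empty conjunction means $\mathrm{emp}$); $s,h\models\mathrm{lseg}(x,z)$ iff there are $n\ge0$ and integers $a_0,\dots,a_n$ with $a_0=s(x)$, $a_n=s(z)$, $a_i\ne s(z)$ for $i<n$ and $h=\{a_0\mapsto a_1\}\ast\dots\ast\{a_{n-1}\mapsto a_n\}$. Definitions: $\mathrm{Empty}(\mathrm{emp})=\top$, $\mathrm{Empty}(\mathrm{next}(x,y))=\bot$, $\mathrm{Empty}(\mathrm{lseg}(x,y))=(x\simeq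 y)$; $\mathrm{Addr}(\mathrm{next}(x,y))=\mathrm{Addr}(\mathrm{lseg}(x,y))=x$. $\mathrm{Collide}(S,S')=\lnot\mathrm{Empty}(S)\land\lnot\mathrm{Empty}(S')\land\mathrm{Addr}(S)\simeq\mathrm{Addr}(S')$ ($\bot$ if either is $\mathrm{emp}$). $\mathrm{WellFormed}(S_1\ast\dots\ast S_n)=\bigwedge_{1\le i<j\le n}\lnot\mathrm{Collide}(S_i,S_j)$. -}

module Defs where

open import Data.Bool using (Bool; true; false; _∧_; not; if_then_else_)
open import Data.Integer using (ℤ)
import Data.Integer.Properties as ℤP
open import Data.Nat using (ℕ; suc; _<_)
open import Data.List using (List; []; _∷_; map; upTo)
open import Data.Maybe using (Maybe; just; nothing; _<∣>_)
open import Data.Product using (Σ; ∃; ∃-syntax; _×_; _,_)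
open import Data.Sum using (_⊎_)
open import Relation.Nullary using (¬_)
open import Relation.Nullary.Decidable using (⌊_⌋)
open import Relation.Binary.PropositionalEquality using (_≡_; _≢_; refl)
open import Data.Empty using (⊥-elim)

-- The first-order language is kept abstract: a type `Stack` of stacks and a
-- type `IExpr` of pure Int-sorted expressions with their evaluation
-- `ev s e = s(e)`.
module Separation {Stack IExpr : Set} (ev : Stack → IExpr → ℤ) where

  data Form : Set where
    ⊤f ⊥f : Form
    _≃_   : IExpr → IExpr → Form
    ¬f_   : Form → Form
    _∧f_  : Form → Form → Form

  evF : Stack → Form → Bool
  evF s ⊤f = true
  evF s ⊥f = false
  evF s (x ≃ y) = ⌊ ev s x ℤP.≟ ev s y ⌋
  evF s (¬f F) = not (evF s F)
  evF s (F ∧f G) = evF s F ∧ evF s G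

  _⊨_ : Stack → Form → Set
  s ⊨ F = evF s F ≡ true

  -- heaps: partial functions ℤ ⇀ Val (Val = ℤ: only integer values are stored)
  Heap : Set
  Heap = ℤ → Maybe ℤ

  IsEmpty : Heap → Set
  IsEmpty h = ∀ a → h a ≡ nothing

  IsSingleton : ℤ → ℤ → Heap → Set
  IsSingleton a b h = ∀ c → h c ≡ (if ⌊ c ℤP.≟ a ⌋ then just b else nothing)

  Split : Heap → Heap → Heap → Set
  Split h h₁ h₂ = ∀ a → (h₁ a ≡ nothing ⊎ h₂ a ≡ nothing) × h a ≡ (h₁ a <∣> h₂ a)

  StarCells : Heap → List (ℤ × ℤ) → Set
  StarCells h [] = IsEmpty h
  StarCells h ((a , b) ∷ cs) =
    ∃[ h₁ ] ∃[ h₂ ] (Split h h₁ h₂ × IsSingleton a b h₁ × StarCells h₂ cs)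

  data Spatial : Set where
    emp  : Spatial
    next : IExpr → IExpr → Spatial
    lseg : IExpr → IExpr → Spatial

  SpatialConj : Set
  SpatialConj = List Spatial

  _,_⊨ₐ_ : Stack → Heap → Spatial → Set
  s , h ⊨ₐ emp = IsEmpty h
  s , h ⊨ₐ next x y = IsSingleton (ev s x) (ev s y) h
  s , h ⊨ₐ lseg x z =
    ∃[ n ] Σ (ℕ → ℤ) λ a → (a 0 ≡ ev s x × a n ≡ ev s z
      × (∀ i → i < n → a i ≢ ev s z)
      × StarCells h (map (λ i → (a i , a (suc i))) (upTo n)))

  _,_⊨ₛ_ : Stack → Heap → SpatialConj → Set
  s , h ⊨ₛ [] = IsEmpty h
  s , h ⊨ₛ (S ∷ Σs) = ∃[ h₁ ] ∃[ h₂ ] (Split h h₁ h₂ × (s , h₁ ⊨ₐ S) × (s , h₂ ⊨ₛ Σs))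

  Empty : Spatial → Form
  Empty emp = ⊤f
  Empty (next x y) = ⊥f
  Empty (lseg x y) = x ≃ y

  Addr : (S : Spatial) → S ≢ emp → IExpr
  Addr emp ne = ⊥-elim (ne refl)
  Addr (next x y) _ = x
  Addr (lseg x y) _ = x

  Collide : Spatial → Spatial → Form
  Collide emp _ = ⊥f
  Collide (next x y) emp = ⊥f
  Collide (lseg x y) emp = ⊥f
  Collide (next x y) S'@(next _ _) = (¬f Empty (next x y)) ∧f ((¬f Empty S') ∧f (Addr (next x y) (λ ()) ≃ Addr S' (λ ())))
  Collide (next x y) S'@(lseg _ _) = (¬f Empty (next x y)) ∧f ((¬f Empty S') ∧f (Addr (next x y) (λ ()) ≃ Addr S' (λ ())))
  Collide (lseg x y) S'@(next _ _) = (¬f Empty (lseg x y)) ∧f ((¬f Empty S') ∧f (Addr (lseg x y) (λ ()) ≃ Addr S' (λ ())))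
  Collide (lseg x y) S'@(lseg _ _) = (¬f Empty (lseg x y)) ∧f ((¬f Empty S') ∧f (Addr (lseg x y) (λ ()) ≃ Addr S' (λ ())))

  WellFormed : SpatialConj → Form
  WellFormed [] = ⊤f
  WellFormed (S ∷ Σs) = noCollWith Σs ∧f WellFormed Σs
    where
    noCollWith : SpatialConj → Form
    noCollWith [] = ⊤f
    noCollWith (S' ∷ Σs') = (¬f Collide S S') ∧f noCollWith Σs'

-- A non-empty atom allocates-Addr the cell at its address (for lseg(x,z) with
-- x ≠ z this is the first cell of the segment), and the atoms of a satisfied
-- spatial conjunction occupy pairwise disjoint subheaps; so two non-empty
-- atoms with the same address cannot both be satisfied.
module Submission where

open import Defs
open import Data.Integer using (ℤ)
import Data.Integer.Properties as ℤP
open import Data.Bool using (_∧_; not)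
open import Data.Bool.Properties using (¬-not; ∧-conicalˡ; ∧-conicalʳ; T-≡)
open import Data.Nat using (zero; suc)
open import Data.List using ([]; _∷_)
open import Data.Maybe using (just; nothing; _<∣>_)
open import Data.Product using (∃-syntax; _,_; proj₂)
open import Data.Sum using (inj₁; inj₂)
open import Data.Empty using (⊥-elim)
open import Function using (_∘_)
open import Function.Bundles using (Equivalence)
open import Relation.Nullary using (¬_; yes; no)
open import Relation.Nullary.Decidable using (toWitness; toWitnessFalse)
open import Relation.Binary.PropositionalEquality
  using (_≡_; _≢_; refl; sym; trans; cong; cong₂; subst)

module _ {Stack IExpr : Set} (ev : Stack → IExpr → ℤ) where
  open Separation ev

  module _ {s : Stack} where

    ⊨≃⇒≡ : ∀ {x y} → s ⊨ (x ≃ y) → ev s x ≡ ev s y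
    ⊨≃⇒≡ {x} {y} p = toWitness {a? = ev s x ℤP.≟ ev s y} (Equivalence.from T-≡ p)

    ⊨¬≃⇒≢ : ∀ {x y} → s ⊨ (¬f (x ≃ y)) → ev s x ≢ ev s y
    ⊨¬≃⇒≢ {x} {y} p = toWitnessFalse {a? = ev s x ℤP.≟ ev s y} (Equivalence.from T-≡ p)

    ⊨¬f-intro : ∀ {F} → ¬ (s ⊨ F) → s ⊨ (¬f F)
    ⊨¬f-intro ¬p = sym (¬-not (¬p ∘ sym))

  _∈dom_ : ℤ → Heap → Set
  a ∈dom h = ∃[ v ] h a ≡ just v

  Disjoint : Heap → Heap → Set
  Disjoint h₁ h₂ = ∀ {a} → a ∈dom h₁ → ¬ a ∈dom h₂

  module _ {h h₁ h₂ : Heap} (sp : Split h h₁ h₂) where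

    split-disjoint : Disjoint h₁ h₂
    split-disjoint {a} (_ , e₁) (_ , e₂) with sp a
    ... | inj₁ h₁a≡nothing , _ with () ← trans (sym h₁a≡nothing) e₁
    ... | inj₂ h₂a≡nothing , _ with () ← trans (sym h₂a≡nothing) e₂

    split-∈domˡ : ∀ {a} → a ∈dom h₁ → a ∈dom h
    split-∈domˡ {a} (v , e₁) = v , trans (proj₂ (sp a)) (cong (_<∣> h₂ a) e₁)

    split-∈domʳ : ∀ {a} → a ∈dom h₂ → a ∈dom h
    split-∈domʳ {a} (v , e₂) with sp a
    ... | inj₁ h₁a≡nothing , h≡ = v , trans h≡ (cong₂ _<∣>_ h₁a≡nothing e₂)
    ... | inj₂ h₂a≡nothing , _ with () ← trans (sym h₂a≡nothing) e₂

  singleton-∈dom : ∀ {a b h} → IsSingleton a b h → a ∈dom h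
  singleton-∈dom {a} {b} sg with a ℤP.≟ a | sg a
  ... | yes _   | ha≡b = b , ha≡b
  ... | no a≢a | _    = ⊥-elim (a≢a refl)

  allocates-Addr : ∀ {s} {h} S (S≢emp : S ≢ emp) → s , h ⊨ₐ S → s ⊨ (¬f Empty S)
            → ev s (Addr S S≢emp) ∈dom h
  allocates-Addr emp S≢emp _ _ = ⊥-elim (S≢emp refl)
  allocates-Addr (next x y) _ sg _ = singleton-∈dom sg
  allocates-Addr (lseg x z) _ (zero , a , a₀≡x , a₀≡z , _) x≄z =
    ⊥-elim (⊨¬≃⇒≢ x≄z (trans (sym a₀≡x) a₀≡z))
  allocates-Addr {h = h} (lseg x z) _ (suc n , a , a₀≡x , _ , _ , _ , _ , sp , sg , _) _ =
    subst (_∈dom h) a₀≡x (split-∈domˡ sp (singleton-∈dom sg))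

  module _ {s : Stack} {h₁ h₂ : Heap} (disj : Disjoint h₁ h₂) where

    ¬collide-nonEmpty : ∀ S S' (S≢emp : S ≢ emp) (S'≢emp : S' ≢ emp)
      → s , h₁ ⊨ₐ S → s , h₂ ⊨ₐ S'
      → ¬ s ⊨ ((¬f Empty S) ∧f ((¬f Empty S') ∧f (Addr S S≢emp ≃ Addr S' S'≢emp)))
    ¬collide-nonEmpty S S' S≢emp S'≢emp p p' c =
      -- the first conjunct is given explicitly: evF is not injective, so Agda
      -- cannot recover it from the unfolded conjunction
      let c' = ∧-conicalʳ (not (evF s (Empty S))) _ c
      in disj (allocates-Addr S S≢emp p (∧-conicalˡ _ _ c))
              (subst (_∈dom h₂) (sym (⊨≃⇒≡ (∧-conicalʳ _ _ c')))
                     (allocates-Addr S' S'≢emp p' (∧-conicalˡ _ _ c')))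

    ¬collide : ∀ S S' → s , h₁ ⊨ₐ S → s , h₂ ⊨ₐ S' → ¬ s ⊨ Collide S S'
    ¬collide emp _ _ _ ()
    ¬collide (next _ _) emp _ _ ()
    ¬collide (lseg _ _) emp _ _ ()
    ¬collide S@(next _ _) S'@(next _ _) = ¬collide-nonEmpty S S' (λ ()) (λ ())
    ¬collide S@(next _ _) S'@(lseg _ _) = ¬collide-nonEmpty S S' (λ ()) (λ ())
    ¬collide S@(lseg _ _) S'@(next _ _) = ¬collide-nonEmpty S S' (λ ()) (λ ())
    ¬collide S@(lseg _ _) S'@(lseg _ _) = ¬collide-nonEmpty S S' (λ ()) (λ ())

  wellFormed-∷ : ∀ {s} {h₁ h₂} S Σs → Disjoint h₁ h₂ → s , h₁ ⊨ₐ S → s , h₂ ⊨ₛ Σs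
               → s ⊨ WellFormed Σs → s ⊨ WellFormed (S ∷ Σs)
  wellFormed-∷ S [] _ _ _ _ = refl
  wellFormed-∷ {s} S (S' ∷ Σs) disj p (_ , _ , sp , p' , ps) wf =
    cong₂ _∧_ (cong₂ _∧_ apart-from-S' (∧-conicalˡ _ _ wf-S∷Σs)) wf
    where
    apart-from-S' : s ⊨ (¬f Collide S S')
    apart-from-S' = ⊨¬f-intro {F = Collide S S'}
                      (¬collide (λ q → disj q ∘ split-∈domˡ sp) S S' p p')
    wf-S∷Σs : s ⊨ WellFormed (S ∷ Σs)
    wf-S∷Σs = wellFormed-∷ S Σs (λ q → disj q ∘ split-∈domʳ sp) p ps (∧-conicalʳ _ _ wf)

proposition4 : {Stack IExpr : Set} (ev : Stack → IExpr → ℤ)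
    → let open Separation ev in
    (Σs : SpatialConj) (s : Stack) (h : Heap)
    → s , h ⊨ₛ Σs → s ⊨ WellFormed Σs
proposition4 ev [] s h _ = refl
proposition4 ev (S ∷ Σs) s h (_ , h₂ , sp , p , ps) =
  wellFormed-∷ ev S Σs (split-disjoint ev sp) p ps (proposition4 ev Σs s h₂ ps)
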